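{- Let $G=(V,E)$ be a 2-edge-connected graph and $x^*\in\textsc{Subtour}(G)$. Let $F_1,\ldots,F_\ell$ be connectors of $G$ and $\lambda_1,\ldots,\lambda_\ell>0$ with $\sum_i\lambda_i=1$ such that (a) $x^*\ge\sum_i\lambda_i\chi^{F_i}$ and (b) every $F_i$ has an even number of edges (counted with multiplicity) in each 2-edge cut of $G$. For any $F_i$, let $T\subseteq V$ be the set of odd-degree vertices of $F_i$. Then the vector $y\in\mathbb{R}^E$ with $y_e=\frac13$ for all $e\in E$ satisfies $y(\delta(S))\ge 1$ for every $S\subseteq V$ with $|S\cap T|$ odd (and $y\ge 0$).
   Context: $\delta(S)$ is the set of edges with exactly one endpoint in $S$, $y(D)=\sum_{e\in D}y_e$. $\textsc{Subtour}(G)=\{x\in\mathbb{R}^E: x(\delta(S))\ge 2 \text{ for all } \emptyset\ne S\subsetneq V,\ x\ge 0\}$. A connector of $G$ is a multiset $F$ of edges of $G$ containing at most two copies of each edge such that $(V,F)$ is connected and spanning; $\chi^F$ is its incidence vector counting multiplicities; degrees in $F$ count multiplicities. A 2-edge cut of $G$ is a set $\delta(S)$, $\emptyset\ne S\subsetneq V$, with $|\delta(S)|=2$. -}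

module Defs where

open import Data.Nat as ℕ using (ℕ; zero; suc; _≤_; _%_)
open import Data.Fin using (Fin; zero; suc)
open import Data.Fin.Properties using () renaming (_≟_ to _≟ᶠ_)
open import Data.Bool using (Bool; true; false; _xor_; _∧_; if_then_else_)
open import Data.Product using (Σ; _×_; _,_; proj₁; proj₂; ∃)
open import Data.Integer using (+_)
open import Data.Rational as ℚ using (ℚ; 0ℚ; 1ℚ)
open import Relation.Nullary using (¬_)
open import Relation.Nullary.Decidable using (⌊_⌋)
open import Relation.Binary.PropositionalEquality using (_≡_; _≢_)

Σℕ : (k : ℕ) → (Fin k → ℕ) → ℕ
Σℕ zero    f = 0
Σℕ (suc k) f = f zero ℕ.+ Σℕ k (λ i → f (suc i))

Σℚ : (k : ℕ) → (Fin k → ℚ) → ℚ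
Σℚ zero    f = 0ℚ
Σℚ (suc k) f = f zero ℚ.+ Σℚ k (λ i → f (suc i))

record Graph : Set where
  field
    n    : ℕ
    m    : ℕ
    end₁ : Fin m → Fin n
    end₂ : Fin m → Fin n
    loopless : (e : Fin m) → end₁ e ≢ end₂ e

module _ (G : Graph) where
  open Graph G

  VSet : Set
  VSet = Fin n → Bool

  inδ : VSet → Fin m → Bool
  inδ S e = S (end₁ e) xor S (end₂ e)

  NonemptyProper : VSet → Set
  NonemptyProper S = (∃ λ v → S v ≡ true) × (∃ λ v → S v ≡ false)

  cutSize : VSet → ℕ
  cutSize S = Σℕ m (λ e → if inδ S e then 1 else 0)

  cutℚ : (Fin m → ℚ) → VSet → ℚ
  cutℚ z S = Σℚ m (λ e → if inδ S e then z e else 0ℚ)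

  cutℕ : (Fin m → ℕ) → VSet → ℕ
  cutℕ z S = Σℕ m (λ e → if inδ S e then z e else 0)

  data Reach (allowed : Fin m → Set) : Fin n → Fin n → Set where
    here : ∀ {v} → Reach allowed v v
    step₁ : ∀ {w} (e : Fin m) → allowed e → Reach allowed (end₂ e) w → Reach allowed (end₁ e) w
    step₂ : ∀ {w} (e : Fin m) → allowed e → Reach allowed (end₁ e) w → Reach allowed (end₂ e) w

  ConnectedVia : (Fin m → Set) → Set
  ConnectedVia allowed = (u v : Fin n) → Reach allowed u v

  Connected : Set
  Connected = ConnectedVia (λ _ → Data.Unit.⊤)
    where import Data.Unit

  TwoEdgeConnected : Set
  TwoEdgeConnected = Connected × ((f : Fin m) → ConnectedVia (λ e → e ≢ f))

  InSubtour : (Fin m → ℚ) → Set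
  InSubtour x = ((S : VSet) → NonemptyProper S → (+ 2 ℚ./ 1) ℚ.≤ cutℚ x S)
              × ((e : Fin m) → 0ℚ ℚ.≤ x e)

  IsConnector : (Fin m → ℕ) → Set
  IsConnector F = ((e : Fin m) → F e ≤ 2)
                × ConnectedVia (λ e → 1 ≤ F e)

  -- number of endpoints of e equal to v (0 or 1, graph is loopless)
  incid : Fin n → Fin m → ℕ
  incid v e = (if ⌊ end₁ e ≟ᶠ v ⌋ then 1 else 0) ℕ.+ (if ⌊ end₂ e ≟ᶠ v ⌋ then 1 else 0)

  degree : (Fin m → ℕ) → Fin n → ℕ
  degree F v = Σℕ m (λ e → F e ℕ.* incid v e)

  oddVertex : (Fin m → ℕ) → VSet
  oddVertex F v = ⌊ (degree F v % 2) ℕ.≟ 1 ⌋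

  countIn : VSet → VSet → ℕ
  countIn S T = Σℕ n (λ v → if S v ∧ T v then 1 else 0)

  yThird : Fin m → ℚ
  yThird _ = + 1 ℚ./ 3

-- An odd number of T-vertices in S forces an odd number of F-edges (with
-- multiplicity) in δ(S), by the handshake lemma counted inside S.  So δ(S) is
-- nonempty, S is a proper nonempty set, and 2-edge-connectivity gives
-- |δ(S)| ≥ 2; a 2-edge cut is excluded because F meets it evenly.  Hence
-- |δ(S)| ≥ 3 and y(δ(S)) = |δ(S)|/3 ≥ 1.
module Submission where

open import Defs
open import Data.Bool using (Bool; true; false; _xor_; _∧_; if_then_else_)
open import Data.Bool.Properties using (if-eta)
open import Data.Empty using (⊥-elim)
open import Data.Fin using (Fin; zero; suc)
open import Data.Fin.Properties using () renaming (_≟_ to _≟ᶠ_)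
open import Data.Integer using (+_)
open import Data.Nat as ℕ using (ℕ; zero; suc; _+_; _*_; _≤_; _%_; NonZero; z≤n; s≤s)
open import Data.Nat.DivMod using (%-distribˡ-+; m*n%n≡0; m%n<n)
import Data.Nat.Properties as ℕₚ
open import Data.Product using (_×_; _,_; ∃)
open import Data.Rational as ℚ using (ℚ; 0ℚ; 1ℚ)
import Data.Rational.Properties as ℚₚ
open import Relation.Nullary.Decidable using (⌊_⌋; ⌊⌋-map′)
open import Relation.Binary.PropositionalEquality
  using (_≡_; _≢_; refl; sym; trans; cong; cong₂; subst)
open import Algebra.Definitions.RawMonoid ℚ.+-0-rawMonoid using () renaming (_×_ to _·_)
open import Algebra.Properties.CommutativeSemigroup ℕₚ.+-commutativeSemigroup using (interchange)
open Relation.Binary.PropositionalEquality.≡-Reasoning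

-- cutSize G S unfolds to count m (inδ G S).
count : ∀ k → (Fin k → Bool) → ℕ
count k b = Σℕ k (λ i → if b i then 1 else 0)

Σℕ-cong : ∀ k {f g : Fin k → ℕ} → (∀ i → f i ≡ g i) → Σℕ k f ≡ Σℕ k g
Σℕ-cong zero    f≗g = refl
Σℕ-cong (suc k) f≗g = cong₂ _+_ (f≗g zero) (Σℕ-cong k (λ i → f≗g (suc i)))

Σℕ-zero : ∀ k → Σℕ k (λ _ → 0) ≡ 0
Σℕ-zero zero    = refl
Σℕ-zero (suc k) = Σℕ-zero k

Σℕ-+ : ∀ k (f g : Fin k → ℕ) → Σℕ k (λ i → f i + g i) ≡ Σℕ k f + Σℕ k g
Σℕ-+ zero    f g = refl
Σℕ-+ (suc k) f g = begin
  f zero + g zero + Σℕ k (λ i → f (suc i) + g (suc i))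
    ≡⟨ cong (_+_ (f zero + g zero)) (Σℕ-+ k (λ i → f (suc i)) (λ i → g (suc i))) ⟩
  f zero + g zero + (Σℕ k (λ i → f (suc i)) + Σℕ k (λ i → g (suc i)))
    ≡⟨ interchange (f zero) (g zero) _ _ ⟩
  Σℕ (suc k) f + Σℕ (suc k) g ∎

Σℕ-comm : ∀ a b (f : Fin a → Fin b → ℕ) →
          Σℕ a (λ i → Σℕ b (f i)) ≡ Σℕ b (λ j → Σℕ a (λ i → f i j))
Σℕ-comm zero    b f = sym (Σℕ-zero b)
Σℕ-comm (suc a) b f = begin
  Σℕ b (f zero) + Σℕ a (λ i → Σℕ b (f (suc i)))
    ≡⟨ cong (_+_ (Σℕ b (f zero))) (Σℕ-comm a b (λ i → f (suc i))) ⟩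
  Σℕ b (f zero) + Σℕ b (λ j → Σℕ a (λ i → f (suc i) j))
    ≡⟨ Σℕ-+ b (f zero) (λ j → Σℕ a (λ i → f (suc i) j)) ⟨
  Σℕ b (λ j → Σℕ (suc a) (λ i → f i j)) ∎

if-Σℕ : ∀ b k (f : Fin k → ℕ) →
        (if b then Σℕ k f else 0) ≡ Σℕ k (λ i → if b then f i else 0)
if-Σℕ true  k f = refl
if-Σℕ false k f = sym (Σℕ-zero k)

Σℕ-select : ∀ k (a : Fin k) (g : Fin k → ℕ) →
            Σℕ k (λ v → if ⌊ a ≟ᶠ v ⌋ then g v else 0) ≡ g a
Σℕ-select (suc k) zero    g = trans (cong (_+_ (g zero)) (Σℕ-zero k)) (ℕₚ.+-identityʳ (g zero))
Σℕ-select (suc k) (suc a) g = begin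
  Σℕ k (λ v → if ⌊ suc a ≟ᶠ suc v ⌋ then g (suc v) else 0)
    ≡⟨ Σℕ-cong k (λ v → cong (if_then g (suc v) else 0) (⌊⌋-map′ _ _ (a ≟ᶠ v))) ⟩
  Σℕ k (λ v → if ⌊ a ≟ᶠ v ⌋ then g (suc v) else 0)
    ≡⟨ Σℕ-select k a (λ v → g (suc v)) ⟩
  g (suc a) ∎

Σℕ-%-cong : ∀ k d .{{_ : NonZero d}} {f g : Fin k → ℕ} →
            (∀ i → f i % d ≡ g i % d) → Σℕ k f % d ≡ Σℕ k g % d
Σℕ-%-cong zero    d f≡g = refl
Σℕ-%-cong (suc k) d {f} {g} f≡g = begin
  (f zero + Σℕ k (λ i → f (suc i))) % d
    ≡⟨ %-distribˡ-+ (f zero) _ d ⟩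
  (f zero % d + Σℕ k (λ i → f (suc i)) % d) % d
    ≡⟨ cong₂ (λ x y → (x + y) % d) (f≡g zero) (Σℕ-%-cong k d (λ i → f≡g (suc i))) ⟩
  (g zero % d + Σℕ k (λ i → g (suc i)) % d) % d
    ≡⟨ %-distribˡ-+ (g zero) _ d ⟨
  (g zero + Σℕ k (λ i → g (suc i))) % d ∎

Σℕ-if≢0⇒∃ : ∀ k (b : Fin k → Bool) (h : Fin k → ℕ) →
            Σℕ k (λ i → if b i then h i else 0) ≢ 0 → ∃ λ i → b i ≡ true
Σℕ-if≢0⇒∃ zero    b h ≢0 = ⊥-elim (≢0 refl)
Σℕ-if≢0⇒∃ (suc k) b h ≢0 with b zero in eq
... | true  = zero , eq
... | false with Σℕ-if≢0⇒∃ k (λ i → b (suc i)) (λ i → h (suc i)) ≢0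
...   | i , bi = suc i , bi

count-≥1 : ∀ k (b : Fin k → Bool) (i : Fin k) → b i ≡ true → 1 ≤ count k b
count-≥1 (suc k) b zero    bi rewrite bi = s≤s z≤n
count-≥1 (suc k) b (suc i) bi =
  ℕₚ.≤-trans (count-≥1 k (λ j → b (suc j)) i bi) (ℕₚ.m≤n+m _ (if b zero then 1 else 0))

count-≥2 : ∀ k (b : Fin k → Bool) (i j : Fin k) → i ≢ j → b i ≡ true → b j ≡ true →
           2 ≤ count k b
count-≥2 (suc k) b zero    zero    i≢j bi bj = ⊥-elim (i≢j refl)
count-≥2 (suc k) b zero    (suc j) i≢j bi bj rewrite bi = s≤s (count-≥1 k (λ l → b (suc l)) j bj)
count-≥2 (suc k) b (suc i) zero    i≢j bi bj rewrite bj = s≤s (count-≥1 k (λ l → b (suc l)) i bi)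
count-≥2 (suc k) b (suc i) (suc j) i≢j bi bj =
  ℕₚ.≤-trans (count-≥2 k (λ l → b (suc l)) i j (λ i≡j → i≢j (cong suc i≡j)) bi bj)
             (ℕₚ.m≤n+m _ (if b zero then 1 else 0))

Σℚ-if≡count· : ∀ k (b : Fin k → Bool) (q : ℚ) →
               Σℚ k (λ i → if b i then q else 0ℚ) ≡ count k b · q
Σℚ-if≡count· zero    b q = refl
Σℚ-if≡count· (suc k) b q with b zero
... | true  = cong (q ℚ.+_) (Σℚ-if≡count· k (λ i → b (suc i)) q)
... | false = trans (ℚₚ.+-identityˡ _) (Σℚ-if≡count· k (λ i → b (suc i)) q)

·-nonNeg : ∀ k {q} → 0ℚ ℚ.≤ q → 0ℚ ℚ.≤ k · q
·-nonNeg zero    q≥0 = ℚₚ.≤-refl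
·-nonNeg (suc k) q≥0 = ℚₚ.+-mono-≤ q≥0 (·-nonNeg k q≥0)

·-monoˡ-≤ : ∀ {k l q} → 0ℚ ℚ.≤ q → k ≤ l → k · q ℚ.≤ l · q
·-monoˡ-≤ {l = l} q≥0 z≤n     = ·-nonNeg l q≥0
·-monoˡ-≤ {q = q} q≥0 (s≤s k≤l) = ℚₚ.+-monoʳ-≤ q (·-monoˡ-≤ q≥0 k≤l)

odd-indicator-%2 : ∀ d → (if ⌊ d % 2 ℕ.≟ 1 ⌋ then 1 else 0) % 2 ≡ d % 2
odd-indicator-%2 d with d % 2 | m%n<n d 2
... | 0 | _ = refl
... | 1 | _ = refl
... | suc (suc _) | s≤s (s≤s ())

if-+-if-%2 : ∀ a b k →
             ((if a then k else 0) + (if b then k else 0)) % 2 ≡ (if a xor b then k else 0) % 2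
if-+-if-%2 true  true  k = begin
  (k + k) % 2       ≡⟨ cong (λ x → (k + x) % 2) (ℕₚ.+-identityʳ k) ⟨
  (2 * k) % 2       ≡⟨ cong (_% 2) (ℕₚ.*-comm 2 k) ⟩
  (k * 2) % 2       ≡⟨ m*n%n≡0 k 2 ⟩
  0                 ∎
if-+-if-%2 true  false k = cong (_% 2) (ℕₚ.+-identityʳ k)
if-+-if-%2 false true  k = refl
if-+-if-%2 false false k = refl

if-*-incidence : ∀ s a b k →
  (if s then k * ((if a then 1 else 0) + (if b then 1 else 0)) else 0)
  ≡ (if a then (if s then k else 0) else 0) + (if b then (if s then k else 0) else 0)
if-*-incidence false a     b     k = sym (cong₂ _+_ (if-eta a) (if-eta b))
if-*-incidence true  true  true  k = trans (ℕₚ.*-comm k 2) (cong (_+_ k) (ℕₚ.+-identityʳ k))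
if-*-incidence true  true  false k = trans (ℕₚ.*-identityʳ k) (sym (ℕₚ.+-identityʳ k))
if-*-incidence true  false true  k = ℕₚ.*-identityʳ k
if-*-incidence true  false false k = ℕₚ.*-zeroʳ k

module _ (G : Graph) where
  open Graph G

  Σ-degree-inside : ∀ (F : Fin m → ℕ) (S : VSet G) →
    Σℕ n (λ v → if S v then degree G F v else 0)
    ≡ Σℕ m (λ e → (if S (end₁ e) then F e else 0) + (if S (end₂ e) then F e else 0))
  Σ-degree-inside F S = begin
    Σℕ n (λ v → if S v then degree G F v else 0)
      ≡⟨ Σℕ-cong n (λ v → if-Σℕ (S v) m _) ⟩
    Σℕ n (λ v → Σℕ m (λ e → if S v then F e * incid G v e else 0))
      ≡⟨ Σℕ-comm n m _ ⟩
    Σℕ m (λ e → Σℕ n (λ v → if S v then F e * incid G v e else 0))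
      ≡⟨ Σℕ-cong m edge ⟩
    Σℕ m (λ e → (if S (end₁ e) then F e else 0) + (if S (end₂ e) then F e else 0)) ∎
    where
    edge : ∀ e → Σℕ n (λ v → if S v then F e * incid G v e else 0)
                 ≡ (if S (end₁ e) then F e else 0) + (if S (end₂ e) then F e else 0)
    edge e = begin
      Σℕ n (λ v → if S v then F e * incid G v e else 0)
        ≡⟨ Σℕ-cong n (λ v → if-*-incidence (S v) ⌊ end₁ e ≟ᶠ v ⌋ ⌊ end₂ e ≟ᶠ v ⌋ (F e)) ⟩
      Σℕ n (λ v → (if ⌊ end₁ e ≟ᶠ v ⌋ then inS v else 0) + (if ⌊ end₂ e ≟ᶠ v ⌋ then inS v else 0))
        ≡⟨ Σℕ-+ n _ _ ⟩
      Σℕ n (λ v → if ⌊ end₁ e ≟ᶠ v ⌋ then inS v else 0) + Σℕ n (λ v → if ⌊ end₂ e ≟ᶠ v ⌋ then inS v else 0)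
        ≡⟨ cong₂ _+_ (Σℕ-select n (end₁ e) inS) (Σℕ-select n (end₂ e) inS) ⟩
      inS (end₁ e) + inS (end₂ e) ∎
      where
      inS : Fin n → ℕ
      inS v = if S v then F e else 0

  countIn-oddVertex≡cutℕ-mod2 : ∀ (F : Fin m → ℕ) (S : VSet G) →
                                countIn G S (oddVertex G F) % 2 ≡ cutℕ G F S % 2
  countIn-oddVertex≡cutℕ-mod2 F S = begin
    countIn G S (oddVertex G F) % 2
      ≡⟨ Σℕ-%-cong n 2 odd≡degree ⟩
    Σℕ n (λ v → if S v then degree G F v else 0) % 2
      ≡⟨ cong (_% 2) (Σ-degree-inside F S) ⟩
    Σℕ m (λ e → (if S (end₁ e) then F e else 0) + (if S (end₂ e) then F e else 0)) % 2
      ≡⟨ Σℕ-%-cong m 2 (λ e → if-+-if-%2 (S (end₁ e)) (S (end₂ e)) (F e)) ⟩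
    cutℕ G F S % 2 ∎
    where
    odd≡degree : ∀ v → (if S v ∧ oddVertex G F v then 1 else 0) % 2
                       ≡ (if S v then degree G F v else 0) % 2
    odd≡degree v with S v
    ... | true  = odd-indicator-%2 (degree G F v)
    ... | false = refl

  Reach⇒crossing : ∀ {allowed : Fin m → Set} (S : VSet G) {u v} →
                   Reach G allowed u v → S u ≡ true → S v ≡ false →
                   ∃ λ e → allowed e × inδ G S e ≡ true
  Reach⇒crossing S here Su Sv with () ← trans (sym Su) Sv
  Reach⇒crossing S (step₁ e ok r) Su Sv with S (end₂ e) in S₂
  ... | true  = Reach⇒crossing S r S₂ Sv
  ... | false = e , ok , cong₂ _xor_ Su S₂
  Reach⇒crossing S (step₂ e ok r) Su Sv with S (end₁ e) in S₁
  ... | true  = Reach⇒crossing S r S₁ Sv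
  ... | false = e , ok , cong₂ _xor_ S₁ Su

  inδ⇒NonemptyProper : ∀ (S : VSet G) e → inδ G S e ≡ true → NonemptyProper G S
  inδ⇒NonemptyProper S e e∈δ with S (end₁ e) in S₁ | S (end₂ e) in S₂
  ... | true  | false = (end₁ e , S₁) , (end₂ e , S₂)
  ... | false | true  = (end₂ e , S₂) , (end₁ e , S₁)
  inδ⇒NonemptyProper S e () | true  | true
  inδ⇒NonemptyProper S e () | false | false

  cutℕ≢0⇒NonemptyProper : ∀ (F : Fin m → ℕ) (S : VSet G) → cutℕ G F S ≢ 0 → NonemptyProper G S
  cutℕ≢0⇒NonemptyProper F S Fδ≢0 with e , e∈δ ← Σℕ-if≢0⇒∃ m (inδ G S) F Fδ≢0 =
    inδ⇒NonemptyProper S e e∈δ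

  TwoEdgeConnected⇒2≤cutSize : TwoEdgeConnected G → ∀ (S : VSet G) → NonemptyProper G S →
                               2 ≤ cutSize G S
  TwoEdgeConnected⇒2≤cutSize (conn , conn-f) S ((u , Su) , (v , Sv))
    with f , _ , f∈δ ← Reach⇒crossing S (conn u v) Su Sv
    with g , g≢f , g∈δ ← Reach⇒crossing S (conn-f f u v) Su Sv
    = count-≥2 m (inδ G S) g f g≢f g∈δ f∈δ

lemma6 : (G : Graph) → TwoEdgeConnected G →
         (x : Fin (Graph.m G) → ℚ) → InSubtour G x →
         (ℓ : ℕ) → (F : Fin ℓ → Fin (Graph.m G) → ℕ) → (lam : Fin ℓ → ℚ) →
         ((i : Fin ℓ) → IsConnector G (F i)) →
         ((i : Fin ℓ) → 0ℚ ℚ.< lam i) →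
         Σℚ ℓ lam ≡ 1ℚ →
         ((e : Fin (Graph.m G)) → Σℚ ℓ (λ i → lam i ℚ.* (+ (F i e) ℚ./ 1)) ℚ.≤ x e) →
         ((i : Fin ℓ) → (S : VSet G) → NonemptyProper G S → cutSize G S ≡ 2 →
            cutℕ G (F i) S % 2 ≡ 0) →
         (i : Fin ℓ) →
         ((S : VSet G) → countIn G S (oddVertex G (F i)) % 2 ≡ 1 →
            1ℚ ℚ.≤ cutℚ G (yThird G) S)
         × ((e : Fin (Graph.m G)) → 0ℚ ℚ.≤ yThird G e)
lemma6 G 2ec _ _ _ F _ _ _ _ _ F-even i = y-odd-cut≥1 , λ _ → third≥0
  where
  open Graph G

  third≥0 : 0ℚ ℚ.≤ + 1 ℚ./ 3
  third≥0 = ℚₚ.nonNegative⁻¹ _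

  y-odd-cut≥1 : (S : VSet G) → countIn G S (oddVertex G (F i)) % 2 ≡ 1 →
                1ℚ ℚ.≤ cutℚ G (yThird G) S
  y-odd-cut≥1 S S∩T-odd =
    subst (1ℚ ℚ.≤_) (sym (Σℚ-if≡count· m (inδ G S) _)) (·-monoˡ-≤ {3} third≥0 3≤cutSize)
    where
    Fδ-odd : cutℕ G (F i) S % 2 ≡ 1
    Fδ-odd = trans (sym (countIn-oddVertex≡cutℕ-mod2 G (F i) S)) S∩T-odd

    S-proper : NonemptyProper G S
    S-proper = cutℕ≢0⇒NonemptyProper G (F i) S
                 (λ Fδ≡0 → ℕₚ.0≢1+n (trans (sym (cong (_% 2) Fδ≡0)) Fδ-odd))

    3≤cutSize : 3 ≤ cutSize G S
    3≤cutSize = ℕₚ.≤∧≢⇒< (TwoEdgeConnected⇒2≤cutSize G 2ec S S-proper)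
                         (λ 2≡cut → ℕₚ.0≢1+n (trans (sym (F-even i S S-proper (sym 2≡cut))) Fδ-odd))
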